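{- Let $c\ge 2$ and $n\ge 1$ be integers and $a\neq b$ colors in $\{1,\dots,c\}$. Then $$\left|\Pi_n^{eq}\wr C_c(1^a1^a1^b)\right|=\left|\Pi_n^{eq}\wr C_c(1^a1^b1^a)\right|.$$
   Context: $\Pi_n\wr C_c$ is the set of colored set partitions of $[n]$: a set partition of $[n]$ together with a color in $\{1,\dots,c\}$ for each element. For colors $\gamma_1,\gamma_2,\gamma_3$, a colored partition eq-contains $1^{\gamma_1}1^{\gamma_2}1^{\gamma_3}$ iff some block contains elements $x<y<z$ with $x,y,z$ colored $\gamma_1,\gamma_2,\gamma_3$ respectively; $\Pi_n^{eq}\wr C_c(P)$ is the set of colored partitions not eq-containing $P$. -}

module Defs where

open import Data.Nat using (ℕ; zero; suc)
open import Data.Fin using (Fin; _<_)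
open import Data.Fin.Properties using (any?; all?; _≟_; _<?_)
open import Data.Vec using (Vec; []; _∷_; lookup)
open import Data.List using (List; []; _∷_; map; cartesianProduct; concatMap; allFin; filter; length)
open import Data.Product using (Σ; ∃; _×_; _,_; proj₁; proj₂)
open import Data.Sum using (_⊎_)
open import Relation.Binary.PropositionalEquality using (_≡_)
open import Relation.Nullary using (Dec; ¬_)
open import Relation.Nullary.Decidable using (_×-dec_; _⊎-dec_; ¬?)

allVecs : {A : Set} → List A → (n : ℕ) → List (Vec A n)
allVecs xs zero    = [] ∷ []
allVecs xs (suc n) = concatMap (λ x → map (x ∷_) (allVecs xs n)) xs

-- A set partition of [n] = {0,…,n-1} is encoded by its block-label vector w
-- (element i lies in block w[i]), in the canonical form where blocks are
-- numbered 0,1,2,… in order of their least elements (restricted growth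
-- string): each label is 0 or is one more than a label occurring earlier.
-- This is a bijective encoding of set partitions of [n].
IsCanonical : {n : ℕ} → Vec (Fin n) n → Set
IsCanonical {n} w =
  (i : Fin n) → (Data.Fin.toℕ (lookup w i) ≡ 0)
              ⊎ (∃ λ (j : Fin n) → (j < i) × (suc (Data.Fin.toℕ (lookup w j)) ≡ Data.Fin.toℕ (lookup w i)))

isCanonical? : {n : ℕ} → (w : Vec (Fin n) n) → Dec (IsCanonical w)
isCanonical? {n} w =
  all? (λ i → (Data.Nat._≟_ (Data.Fin.toℕ (lookup w i)) 0)
       ⊎-dec any? (λ j → (j <? i) ×-dec
                         Data.Nat._≟_ (suc (Data.Fin.toℕ (lookup w j))) (Data.Fin.toℕ (lookup w i))))

ColoredPartition : ℕ → ℕ → Set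
ColoredPartition n c = Vec (Fin n) n × Vec (Fin c) n

EqContains : {n c : ℕ} → ColoredPartition n c → Fin c → Fin c → Fin c → Set
EqContains {n} (w , col) g1 g2 g3 =
  ∃ λ (x : Fin n) → ∃ λ (y : Fin n) → ∃ λ (z : Fin n) →
    (x < y) × (y < z) ×
    (lookup w x ≡ lookup w y) × (lookup w y ≡ lookup w z) ×
    (lookup col x ≡ g1) × (lookup col y ≡ g2) × (lookup col z ≡ g3)

eqContains? : {n c : ℕ} → (p : ColoredPartition n c) → (g1 g2 g3 : Fin c) →
              Dec (EqContains p g1 g2 g3)
eqContains? (w , col) g1 g2 g3 =
  any? λ x → any? λ y → any? λ z →
    (x <? y) ×-dec (y <? z) ×-dec
    (lookup w x ≟ lookup w y) ×-dec (lookup w y ≟ lookup w z) ×-dec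
    (lookup col x ≟ g1) ×-dec (lookup col y ≟ g2) ×-dec (lookup col z ≟ g3)

allColoredPartitions : (n c : ℕ) → List (ColoredPartition n c)
allColoredPartitions n c =
  cartesianProduct (filter isCanonical? (allVecs (allFin n) n)) (allVecs (allFin c) n)

numAvoiding : (n c : ℕ) → Fin c → Fin c → Fin c → ℕ
numAvoiding n c g1 g2 g3 =
  length (filter (λ p → ¬? (eqContains? p g1 g2 g3)) (allColoredPartitions n c))

-- Call an element i of a coloured partition *marked* if some
-- smaller element of its block is coloured a.  The recolouring map keeps the
-- partition and applies the transposition (a b) to the colour of every marked
-- element.  The least a-coloured element of a block is unmarked, so it keeps
-- colour a; hence the set of marked elements is unchanged by recolouring and
-- the map is an involution.  An occurrence x < y < z of 1^a 1^g 1^h moves to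
-- an occurrence of 1^a 1^(a b)g 1^(a b)h (after replacing x by the least
-- a-coloured element of the block), so recolouring exchanges the partitions
-- containing 1^a 1^a 1^b with those containing 1^a 1^b 1^a.
module Submission where

open import Defs
open import Data.Nat using (ℕ; _≤_)
open import Data.Fin using (Fin)
open import Relation.Binary.PropositionalEquality using (_≡_; _≢_)

import Data.Nat as ℕ
open import Data.Fin using (_<_; toℕ)
open import Data.Fin.Properties using (any?; _≟_; _<?_)
open import Data.Nat.Properties using (≤-refl; ≤-trans; ≤-<-trans; <-trans; <⇒≤)
open import Data.Fin.Induction using (<-wellFounded)
open import Data.Fin.Permutation.Components using (transpose)
open import Data.Vec using (Vec; []; _∷_; lookup; tabulate)
open import Data.Vec.Properties using (lookup∘tabulate; tabulate∘lookup; tabulate-cong; ∷-injective)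
open import Data.List using (List; []; _∷_; map; filter; length; allFin; cartesianProductWith; concatMap; _++_)
open import Data.List.Membership.Propositional using (_∈_)
open import Data.List.Membership.Propositional.Properties using (∈-map⁺; ∈-map⁻; ∈-cartesianProductWith⁺; ∈-cartesianProductWith⁻; ∈-allFin)
open import Data.List.Membership.Propositional.Properties.WithK using (unique∧set⇒bag)
import Data.List.Relation.Unary.All as All
import Data.List.Relation.Unary.AllPairs as AllPairs
open import Data.List.Relation.Unary.Any using (here)
import Data.List.Relation.Unary.Unique.Propositional as Unique
open Unique using (Unique)
import Data.List.Relation.Unary.Unique.Propositional.Properties as Unique
open import Data.List.Relation.Binary.BagAndSetEquality using (∼bag⇒↭)
open import Data.List.Relation.Binary.Permutation.Propositional using (_↭_)
open import Data.List.Relation.Binary.Permutation.Propositional.Properties using (↭-length; filter-↭)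
open import Data.Product using (∃; _×_; _,_; proj₁; proj₂)
open import Function.Base using (_∘_)
open import Function.Bundles using (_⇔_; mk⇔; Equivalence)
open import Induction.WellFounded using (Acc; acc)
open import Relation.Nullary using (Dec; yes; no; ¬_; contradiction; contraposition)
open import Relation.Nullary.Decidable using (¬?; _×-dec_; dec-true; dec-false)
open import Relation.Unary using (Decidable)
open import Relation.Binary.PropositionalEquality using (refl; sym; trans; cong; subst; subst₂; module ≡-Reasoning)

module CountingByInvolution {A : Set} (φ : A → A) (φ-involutive : ∀ x → φ (φ x) ≡ x) where

  φ-injective : ∀ {x y} → φ x ≡ φ y → x ≡ y
  φ-injective {x} {y} φx≡φy = begin
    x         ≡⟨ sym (φ-involutive x) ⟩
    φ (φ x)   ≡⟨ cong φ φx≡φy ⟩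
    φ (φ y)   ≡⟨ φ-involutive y ⟩
    y         ∎
    where open ≡-Reasoning

  map-↭ : (L : List A) → Unique L → (∀ {x} → x ∈ L → φ x ∈ L) → map φ L ↭ L
  map-↭ L uniqueL closed = ∼bag⇒↭ (unique∧set⇒bag (Unique.map⁺ φ-injective uniqueL) uniqueL (mk⇔ to from))
    where
    to : ∀ {x} → x ∈ map φ L → x ∈ L
    to x∈ with ∈-map⁻ φ x∈
    ... | _ , y∈L , refl = closed y∈L

    from : ∀ {x} → x ∈ L → x ∈ map φ L
    from {x} x∈L = subst (_∈ map φ L) (φ-involutive x) (∈-map⁺ φ (closed x∈L))

  module _ {P Q : A → Set} (P? : Decidable P) (Q? : Decidable Q)
           (intertwines : ∀ x → P x ⇔ Q (φ x)) where

    length-filter-map : ∀ xs → length (filter Q? (map φ xs)) ≡ length (filter P? xs)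
    length-filter-map []       = refl
    length-filter-map (x ∷ xs) with P? x | Q? (φ x)
    ... | yes _  | yes _  = cong ℕ.suc (length-filter-map xs)
    ... | no _   | no _   = length-filter-map xs
    ... | yes p  | no ¬q  = contradiction (Equivalence.to (intertwines x) p) ¬q
    ... | no ¬p  | yes q  = contradiction (Equivalence.from (intertwines x) q) ¬p

    count : (L : List A) → Unique L → (∀ {x} → x ∈ L → φ x ∈ L) →
            length (filter P? L) ≡ length (filter Q? L)
    count L uniqueL closed = trans (sym (length-filter-map L))
                                   (↭-length (filter-↭ Q? (map-↭ L uniqueL closed)))

allVecs-suc : {B : Set} (xs : List B) (n : ℕ) →
              allVecs xs (ℕ.suc n) ≡ cartesianProductWith _∷_ xs (allVecs xs n)
allVecs-suc xs n = concatMap≡cartesianProductWith xs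
  where
  concatMap≡cartesianProductWith : ∀ ys →
    concatMap (λ y → map (y ∷_) (allVecs xs n)) ys ≡ cartesianProductWith _∷_ ys (allVecs xs n)
  concatMap≡cartesianProductWith []       = refl
  concatMap≡cartesianProductWith (y ∷ ys) = cong (map (y ∷_) (allVecs xs n) ++_) (concatMap≡cartesianProductWith ys)

allVecs-unique : {B : Set} (xs : List B) → Unique xs → ∀ n → Unique (allVecs xs n)
allVecs-unique xs uniqueXs ℕ.zero    = All.[] AllPairs.∷ AllPairs.[]
allVecs-unique xs uniqueXs (ℕ.suc n) rewrite allVecs-suc xs n =
  Unique.cartesianProductWith⁺ _∷_ ∷-injective uniqueXs (allVecs-unique xs uniqueXs n)

allVecs-complete : ∀ {m} n (v : Vec (Fin m) n) → v ∈ allVecs (allFin m) n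
allVecs-complete ℕ.zero    []      = here refl
allVecs-complete {m} (ℕ.suc n) (x ∷ v) rewrite allVecs-suc (allFin m) n =
  ∈-cartesianProductWith⁺ _∷_ (∈-allFin x) (allVecs-complete n v)

allColoredPartitions-unique : ∀ n c → Unique (allColoredPartitions n c)
allColoredPartitions-unique n c =
  Unique.cartesianProduct⁺ (Unique.filter⁺ isCanonical? (allVecs-unique _ (Unique.allFin⁺ n) n))
                           (allVecs-unique _ (Unique.allFin⁺ c) n)

allColoredPartitions-recolour : ∀ {n c} {w : Vec (Fin n) n} {col : Vec (Fin c) n} (col′ : Vec (Fin c) n) →
  (w , col) ∈ allColoredPartitions n c → (w , col′) ∈ allColoredPartitions n c
allColoredPartitions-recolour {n} {c} col′ p∈
  with ∈-cartesianProductWith⁻ _,_ (filter isCanonical? (allVecs (allFin n) n)) (allVecs (allFin c) n) p∈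
... | _ , _ , w∈ , _ , refl = ∈-cartesianProductWith⁺ _,_ w∈ (allVecs-complete n col′)

module _ {m : ℕ} {i j : Fin m} where

  transpose-first : transpose i j i ≡ j
  transpose-first rewrite dec-true (i ≟ i) refl = refl

  transpose-second : transpose i j j ≡ i
  transpose-second with i ≟ j
  ... | yes refl = transpose-first
  ... | no i≢j rewrite dec-false (j ≟ i) (i≢j ∘ sym) | dec-true (j ≟ j) refl = refl

  transpose-other : ∀ {k} → k ≢ i → k ≢ j → transpose i j k ≡ k
  transpose-other {k} k≢i k≢j rewrite dec-false (k ≟ i) k≢i | dec-false (k ≟ j) k≢j = refl

  transpose-involutive : ∀ k → transpose i j (transpose i j k) ≡ k
  transpose-involutive k = byCases (k ≟ i) (k ≟ j)
    where
    byCases : Dec (k ≡ i) → Dec (k ≡ j) → transpose i j (transpose i j k) ≡ k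
    byCases (yes refl) _          = trans (cong (transpose i j) transpose-first) transpose-second
    byCases (no _)     (yes refl) = trans (cong (transpose i j) transpose-second) transpose-first
    byCases (no k≢i)   (no k≢j)   = trans (cong (transpose i j) (transpose-other k≢i k≢j)) (transpose-other k≢i k≢j)

module Recolouring {c : ℕ} (a b : Fin c) {n : ℕ} (w : Vec (Fin n) n) where

  σ : Fin c → Fin c
  σ = transpose a b

  Marked : Vec (Fin c) n → Fin n → Set
  Marked col i = ∃ λ j → (j < i) × (lookup w j ≡ lookup w i) × (lookup col j ≡ a)

  marked? : (col : Vec (Fin c) n) → (i : Fin n) → Dec (Marked col i)
  marked? col i = any? (λ j → (j <? i) ×-dec (lookup w j ≟ lookup w i) ×-dec (lookup col j ≟ a))

  recolourAt : {P : Set} → Dec P → Fin c → Fin c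
  recolourAt (yes _) = σ
  recolourAt (no _)  = λ g → g

  recolour : Vec (Fin c) n → Vec (Fin c) n
  recolour col = tabulate (λ i → recolourAt (marked? col i) (lookup col i))

  recolour-marked : ∀ col i → Marked col i → lookup (recolour col) i ≡ σ (lookup col i)
  recolour-marked col i m = trans (lookup∘tabulate _ i) (swaps (marked? col i))
    where
    swaps : (d : Dec (Marked col i)) → recolourAt d (lookup col i) ≡ σ (lookup col i)
    swaps (yes _) = refl
    swaps (no ¬m) = contradiction m ¬m

  recolour-unmarked : ∀ col i → ¬ Marked col i → lookup (recolour col) i ≡ lookup col i
  recolour-unmarked col i ¬m = trans (lookup∘tabulate _ i) (keeps (marked? col i))
    where
    keeps : (d : Dec (Marked col i)) → recolourAt d (lookup col i) ≡ lookup col i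
    keeps (yes m) = contradiction m ¬m
    keeps (no _)  = refl

  FirstA : Vec (Fin c) n → Fin n → Set
  FirstA col j = ∃ λ j₀ → (toℕ j₀ ℕ.≤ toℕ j) × (lookup w j₀ ≡ lookup w j) × (lookup col j₀ ≡ a) × ¬ Marked col j₀

  firstA : ∀ col j → lookup col j ≡ a → FirstA col j
  firstA col j = descend j (<-wellFounded j)
    where
    descend : ∀ j → Acc _<_ j → lookup col j ≡ a → FirstA col j
    descend j (acc below) colj≡a with marked? col j
    ... | no ¬m = j , ≤-refl , refl , colj≡a , ¬m
    ... | yes (k , k<j , wk≡wj , colk≡a) with descend k (below k<j) colk≡a
    ...   | j₀ , j₀≤k , wj₀≡wk , colj₀≡a , ¬m₀ =
            j₀ , ≤-trans j₀≤k (<⇒≤ k<j) , trans wj₀≡wk wk≡wj , colj₀≡a , ¬m₀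

  firstA-recoloured : ∀ col {j} → (f : FirstA col j) →
                      lookup (recolour col) (proj₁ f) ≡ a
  firstA-recoloured col (j₀ , _ , _ , colj₀≡a , ¬m₀) = trans (recolour-unmarked col j₀ ¬m₀) colj₀≡a

  marked-recolour : ∀ col i → Marked col i ⇔ Marked (recolour col) i
  marked-recolour col i = mk⇔ forward backward
    where
    forward : Marked col i → Marked (recolour col) i
    forward (j , j<i , wj≡wi , colj≡a) with firstA col j colj≡a
    ... | f@(j₀ , j₀≤j , wj₀≡wj , _) =
      j₀ , ≤-<-trans j₀≤j j<i , trans wj₀≡wj wj≡wi , firstA-recoloured col f

    backward : Marked (recolour col) i → Marked col i
    backward (j , j<i , wj≡wi , col′j≡a) with marked? col j
    ... | yes (k , k<j , wk≡wj , colk≡a) = k , <-trans k<j j<i , trans wk≡wj wj≡wi , colk≡a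
    ... | no ¬m = j , j<i , wj≡wi , trans (sym (recolour-unmarked col j ¬m)) col′j≡a

  recolour-involutive : ∀ col → recolour (recolour col) ≡ col
  recolour-involutive col = begin
    recolour (recolour col)                    ≡⟨ sym (tabulate∘lookup _) ⟩
    tabulate (lookup (recolour (recolour col))) ≡⟨ tabulate-cong pointwise ⟩
    tabulate (lookup col)                      ≡⟨ tabulate∘lookup col ⟩
    col                                        ∎
    where
    open ≡-Reasoning
    pointwise : ∀ i → lookup (recolour (recolour col)) i ≡ lookup col i
    pointwise i with marked? col i
    ... | yes m = begin
      lookup (recolour (recolour col)) i ≡⟨ recolour-marked (recolour col) i (Equivalence.to (marked-recolour col i) m) ⟩
      σ (lookup (recolour col) i)        ≡⟨ cong σ (recolour-marked col i m) ⟩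
      σ (σ (lookup col i))               ≡⟨ transpose-involutive _ ⟩
      lookup col i                       ∎
    ... | no ¬m = begin
      lookup (recolour (recolour col)) i ≡⟨ recolour-unmarked (recolour col) i (contraposition (Equivalence.from (marked-recolour col i)) ¬m) ⟩
      lookup (recolour col) i            ≡⟨ recolour-unmarked col i ¬m ⟩
      lookup col i                       ∎

  -- An occurrence of 1^a 1^g 1^h becomes an occurrence of 1^a 1^σg 1^σh:
  -- its middle and last elements are marked by its first, which may be
  -- replaced by the (unmarked) least a-coloured element of the block.
  recolour-pattern : ∀ col {g h} → EqContains (w , col) a g h → EqContains (w , recolour col) a (σ g) (σ h)
  recolour-pattern col (x , y , z , x<y , y<z , wx≡wy , wy≡wz , colx≡a , coly≡g , colz≡h)
    with firstA col x colx≡a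
  ... | f@(x₀ , x₀≤x , wx₀≡wx , _) =
    x₀ , y , z , ≤-<-trans x₀≤x x<y , y<z , trans wx₀≡wx wx≡wy , wy≡wz ,
    firstA-recoloured col f ,
    trans (recolour-marked col y (x , x<y , wx≡wy , colx≡a)) (cong σ coly≡g) ,
    trans (recolour-marked col z (x , <-trans x<y y<z , trans wx≡wy wy≡wz , colx≡a)) (cong σ colz≡h)

  exchanges-patterns : ∀ col → EqContains (w , col) a a b ⇔ EqContains (w , recolour col) a b a
  exchanges-patterns col = mk⇔ to from
    where
    σa≡b : σ a ≡ b
    σa≡b = transpose-first {i = a} {j = b}

    σb≡a : σ b ≡ a
    σb≡a = transpose-second {i = a} {j = b}

    to : EqContains (w , col) a a b → EqContains (w , recolour col) a b a
    to e = subst₂ (EqContains (w , recolour col) a) σa≡b σb≡a (recolour-pattern col e)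

    from : EqContains (w , recolour col) a b a → EqContains (w , col) a a b
    from e = subst₂ (EqContains (w , col) a) σb≡a σa≡b
               (subst (λ col′ → EqContains (w , col′) a (σ b) (σ a)) (recolour-involutive col)
                      (recolour-pattern (recolour col) e))

recolourPartition : ∀ {n c} → Fin c → Fin c → ColoredPartition n c → ColoredPartition n c
recolourPartition a b (w , col) = w , Recolouring.recolour a b w col

recolourPartition-involutive : ∀ {n c} (a b : Fin c) (p : ColoredPartition n c) →
                               recolourPartition a b (recolourPartition a b p) ≡ p
recolourPartition-involutive a b (w , col) = cong (w ,_) (Recolouring.recolour-involutive a b w col)

-- Recolouring exchanges avoidance of 1^a 1^a 1^b with avoidance of 1^a 1^b 1^a,
-- and the enumeration is closed under it; count with the involution.
-- (The identity in fact holds for all c, n and all colours a, b.)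
mainTheorem17 : (c n : ℕ) → 2 ≤ c → 1 ≤ n → (a b : Fin c) → a ≢ b →
    numAvoiding n c a a b ≡ numAvoiding n c a b a
mainTheorem17 c n _ _ a b _ =
  count (λ p → ¬? (eqContains? p a a b)) (λ p → ¬? (eqContains? p a b a))
        avoidance-exchanged
        (allColoredPartitions n c) (allColoredPartitions-unique n c)
        (λ {p} → allColoredPartitions-recolour (proj₂ (recolourPartition a b p)))
  where
  open CountingByInvolution (recolourPartition a b) (recolourPartition-involutive a b)

  avoidance-exchanged : ∀ p → (¬ EqContains p a a b) ⇔ (¬ EqContains (recolourPartition a b p) a b a)
  avoidance-exchanged (w , col) = mk⇔ (contraposition from) (contraposition to)
    where open Equivalence (Recolouring.exchanges-patterns a b w col)
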